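{- Let $\mathbb{K}=(G,M,I)$ be a formal context with finite object set $G$ and let $R\subseteq G$ be arbitrary. Then there exists a complete system of $R$-mixed generators in $\mathbb{K}$ which has the semi-downset property.
   Context: For $A\subseteq G$, $A^I=\{n\in M:(a,n)\in I\ \forall a\in A\}$ and dually for $B\subseteq M$. $S\subseteq G$ is an $R$-mixed generator if for every $h\in G$: (i) $h\in S\cap R\Rightarrow(S\setminus\{h\})^{II}\neq S^{II}$; (ii) $h\notin S\cup R\Rightarrow(S\cup\{h\})^{II}\neq S^{II}$. A complete system of $R$-mixed generators is a family $\mathcal{S}$ of $R$-mixed generators such that $S\mapsto S^{II}$ is a bijection from $\mathcal{S}$ onto the set of extents (sets $A$ with $A^{II}=A$) of $\mathbb{K}$. $\mathcal{S}$ has the semi-downset property if $S\in\mathcal{S}$ and $T\subseteq R$ imply $S\setminus T\in\mathcal{S}$. -}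

module Defs where

open import Data.Nat using (ℕ)
open import Data.Fin using (Fin)
open import Data.Fin.Subset using (Subset; _∈_; _∉_; _⊆_; _∪_; _─_; _-_; ⁅_⁆)
open import Data.Product using (_×_; Σ-syntax)
open import Relation.Nullary using (¬_)
open import Relation.Binary.PropositionalEquality using (_≡_)

record Context (n : ℕ) : Set₁ where
  field
    M : Set
    I : Fin n → M → Set

module _ {n : ℕ} (K : Context n) where
  open Context K

  up : Subset n → M → Set
  up A m = ∀ a → a ∈ A → I a m

  down : (M → Set) → Fin n → Set
  down B g = ∀ m → B m → I g m

  closure : Subset n → Fin n → Set
  closure A = down (up A)

  _≐_ : (Fin n → Set) → (Fin n → Set) → Set
  P ≐ Q = ∀ g → (P g → Q g) × (Q g → P g)

  IsExtent : Subset n → Set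
  IsExtent A = closure A ≐ (λ g → g ∈ A)

  IsMixedGenerator : Subset n → Subset n → Set
  IsMixedGenerator R S =
    ∀ h → (h ∈ S → h ∈ R → ¬ (closure (S - h) ≐ closure S))
        × (h ∉ S → h ∉ R → ¬ (closure (S ∪ ⁅ h ⁆) ≐ closure S))

  -- A family 𝒮 of subsets of G (given as a predicate on subsets) is a
  -- complete system of R-mixed generators: every member is an R-mixed
  -- generator and S ↦ S^{II} is a bijection from 𝒮 onto the extents.
  -- (S^{II} is always an extent, so well-definedness of the map is automatic.)
  IsCompleteSystem : Subset n → (Subset n → Set) → Set
  IsCompleteSystem R 𝒮 =
      (∀ S → 𝒮 S → IsMixedGenerator R S)
    × (∀ S T → 𝒮 S → 𝒮 T → closure S ≐ closure T → S ≡ T)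
    × (∀ A → IsExtent A → Σ[ S ∈ Subset n ] (𝒮 S × (closure S ≐ (λ g → g ∈ A))))

  SemiDownset : Subset n → (Subset n → Set) → Set
  SemiDownset R 𝒮 = ∀ S T → 𝒮 S → T ⊆ R → 𝒮 (S ─ T)

-- For every extent A, pick among the sets S with S^{II} = A that agree
-- with A outside R the lexicographically least one. The chosen sets are exactly
-- those S that contain every object of S^{II} outside R and are lexicographically
-- least among the sets with the same closure and the same part outside R.
-- Removing an element of R from such an S would give a smaller set with the same
-- closure, and adding an element outside R cannot keep the closure, so S is an
-- R-mixed generator; two chosen sets with equal closures agree outside R, hence
-- are equal by minimality. Deleting a part T ⊆ R preserves the property: a
-- competitor S' of S ─ T yields the competitor S' ∪ (S ∩ T) of S, and the
-- lexicographic comparison of S with it reduces to that of S ─ T with S'.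
-- Excluded middle provides the least element, as closures need not be decidable.
module Submission where

open import Defs
open import Data.Nat using (ℕ; zero; suc)
open import Data.Fin using (Fin)
open import Data.Bool using (true; false)
open import Data.Vec using ([]; _∷_; here)
open import Data.Fin.Subset using (Subset; _∈_; _∉_; _⊆_; _∪_; _∩_; _─_; _-_; ⁅_⁆)
open import Data.Fin.Subset.Properties
open import Data.Product using (_×_; Σ-syntax; ∃; _,_; proj₁; proj₂; swap)
open import Data.Sum using ([_,_])
open import Data.Unit using (⊤; tt)
open import Data.Empty using (⊥; ⊥-elim)
open import Function using (id)
open import Relation.Nullary using (¬_; yes; no)
open import Relation.Binary.PropositionalEquality using (_≡_; refl; subst; cong)
open import Level using (0ℓ)
open import Axiom.ExcludedMiddle using (ExcludedMiddle)

infix 4 _≤ˡᵉˣ_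

_≤ˡᵉˣ_ : ∀ {n} → Subset n → Subset n → Set
[]          ≤ˡᵉˣ []          = ⊤
(false ∷ p) ≤ˡᵉˣ (false ∷ q) = p ≤ˡᵉˣ q
(false ∷ p) ≤ˡᵉˣ (true  ∷ q) = ⊤
(true  ∷ p) ≤ˡᵉˣ (false ∷ q) = ⊥
(true  ∷ p) ≤ˡᵉˣ (true  ∷ q) = p ≤ˡᵉˣ q

≤ˡᵉˣ-antisym : ∀ {n} (p q : Subset n) → p ≤ˡᵉˣ q → q ≤ˡᵉˣ p → p ≡ q
≤ˡᵉˣ-antisym []          []          _   _   = refl
≤ˡᵉˣ-antisym (false ∷ p) (false ∷ q) p≤q q≤p = cong (false ∷_) (≤ˡᵉˣ-antisym p q p≤q q≤p)
≤ˡᵉˣ-antisym (true  ∷ p) (true  ∷ q) p≤q q≤p = cong (true ∷_) (≤ˡᵉˣ-antisym p q p≤q q≤p)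
≤ˡᵉˣ-antisym (false ∷ p) (true  ∷ q) _   ()
≤ˡᵉˣ-antisym (true  ∷ p) (false ∷ q) ()  _

⊆⇒≤ˡᵉˣ : ∀ {n} (p q : Subset n) → p ⊆ q → p ≤ˡᵉˣ q
⊆⇒≤ˡᵉˣ []          []          _   = tt
⊆⇒≤ˡᵉˣ (false ∷ p) (false ∷ q) p⊆q = ⊆⇒≤ˡᵉˣ p q (drop-∷-⊆ p⊆q)
⊆⇒≤ˡᵉˣ (false ∷ p) (true  ∷ q) _   = tt
⊆⇒≤ˡᵉˣ (true  ∷ p) (false ∷ q) p⊆q with p⊆q here
... | ()
⊆⇒≤ˡᵉˣ (true  ∷ p) (true  ∷ q) p⊆q = ⊆⇒≤ˡᵉˣ p q (drop-∷-⊆ p⊆q)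

p≤ˡᵉˣq∪[p∩r]⇒p─r≤ˡᵉˣq : ∀ {n} (p r q : Subset n) → p ≤ˡᵉˣ q ∪ (p ∩ r) → p ─ r ≤ˡᵉˣ q
p≤ˡᵉˣq∪[p∩r]⇒p─r≤ˡᵉˣq []          []          []          _ = tt
p≤ˡᵉˣq∪[p∩r]⇒p─r≤ˡᵉˣq (true  ∷ p) (true  ∷ r) (false ∷ q) h = p≤ˡᵉˣq∪[p∩r]⇒p─r≤ˡᵉˣq p r q h
p≤ˡᵉˣq∪[p∩r]⇒p─r≤ˡᵉˣq (true  ∷ p) (true  ∷ r) (true  ∷ q) _ = tt
p≤ˡᵉˣq∪[p∩r]⇒p─r≤ˡᵉˣq (true  ∷ p) (false ∷ r) (false ∷ q) ()
p≤ˡᵉˣq∪[p∩r]⇒p─r≤ˡᵉˣq (true  ∷ p) (false ∷ r) (true  ∷ q) h = p≤ˡᵉˣq∪[p∩r]⇒p─r≤ˡᵉˣq p r q h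
p≤ˡᵉˣq∪[p∩r]⇒p─r≤ˡᵉˣq (false ∷ p) (true  ∷ r) (false ∷ q) h = p≤ˡᵉˣq∪[p∩r]⇒p─r≤ˡᵉˣq p r q h
p≤ˡᵉˣq∪[p∩r]⇒p─r≤ˡᵉˣq (false ∷ p) (false ∷ r) (false ∷ q) h = p≤ˡᵉˣq∪[p∩r]⇒p─r≤ˡᵉˣq p r q h
p≤ˡᵉˣq∪[p∩r]⇒p─r≤ˡᵉˣq (false ∷ p) (true  ∷ r) (true  ∷ q) _ = tt
p≤ˡᵉˣq∪[p∩r]⇒p─r≤ˡᵉˣq (false ∷ p) (false ∷ r) (true  ∷ q) _ = tt

p─q∪p∩q≡p : ∀ {n} (p q : Subset n) → (p ─ q) ∪ (p ∩ q) ≡ p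
p─q∪p∩q≡p []          []          = refl
p─q∪p∩q≡p (true  ∷ p) (true  ∷ q) = cong (true ∷_) (p─q∪p∩q≡p p q)
p─q∪p∩q≡p (true  ∷ p) (false ∷ q) = cong (true ∷_) (p─q∪p∩q≡p p q)
p─q∪p∩q≡p (false ∷ p) (true  ∷ q) = cong (false ∷_) (p─q∪p∩q≡p p q)
p─q∪p∩q≡p (false ∷ p) (false ∷ q) = cong (false ∷_) (p─q∪p∩q≡p p q)

≤ˡᵉˣ-least : ExcludedMiddle 0ℓ → ∀ n (P : Subset n → Set) (p : Subset n) → P p →
  Σ[ m ∈ Subset n ] (P m × (∀ q → P q → m ≤ˡᵉˣ q))
≤ˡᵉˣ-least em zero    P [] P[] = [] , P[] , λ { [] _ → tt }
≤ˡᵉˣ-least em (suc n) P p  Pp with em {∃ λ q → P (false ∷ q)}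
... | yes (q , Pq) with ≤ˡᵉˣ-least em n (λ q → P (false ∷ q)) q Pq
...   | m , Pm , least = false ∷ m , Pm , λ { (false ∷ q) Pq → least q Pq ; (true ∷ q) _ → tt }
≤ˡᵉˣ-least em (suc n) P (false ∷ p) Pp | no ¬out = ⊥-elim (¬out (p , Pp))
≤ˡᵉˣ-least em (suc n) P (true  ∷ p) Pp | no ¬out with ≤ˡᵉˣ-least em n (λ q → P (true ∷ q)) p Pp
... | m , Pm , least = true ∷ m , Pm , λ { (false ∷ q) Pq → ⊥-elim (¬out (q , Pq)) ; (true ∷ q) Pq → least q Pq }

module ClosureProperties {n : ℕ} (K : Context n) where

  cl : Subset n → Fin n → Set
  cl = closure K

  infix 4 _≈_
  _≈_ : (Fin n → Set) → (Fin n → Set) → Set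
  _≈_ = _≐_ K

  ≈-sym : ∀ {P Q} → P ≈ Q → Q ≈ P
  ≈-sym P≈Q g = proj₂ (P≈Q g) , proj₁ (P≈Q g)

  ≈-trans : ∀ {P Q U} → P ≈ Q → Q ≈ U → P ≈ U
  ≈-trans P≈Q Q≈U g = (λ x → proj₁ (Q≈U g) (proj₁ (P≈Q g) x))
                    , (λ x → proj₂ (P≈Q g) (proj₂ (Q≈U g) x))

  ∈⇒∈-closure : ∀ {X x} → x ∈ X → cl X x
  ∈⇒∈-closure {x = x} x∈X m upXm = upXm x x∈X

  closure-mono : ∀ {X Y} → X ⊆ Y → ∀ g → cl X g → cl Y g
  closure-mono X⊆Y g g∈X'' m upYm = g∈X'' m (λ a a∈X → upYm a (X⊆Y a∈X))

  closure-cong-∪ʳ : ∀ {X Y} D → cl X ≈ cl Y → cl (X ∪ D) ≈ cl (Y ∪ D)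
  closure-cong-∪ʳ D X''≈Y'' g = ∪ʳ-⊆ X''≈Y'' , ∪ʳ-⊆ (≈-sym X''≈Y'')
    where
    ∪ʳ-⊆ : ∀ {X Y} → cl X ≈ cl Y → cl (X ∪ D) g → cl (Y ∪ D) g
    ∪ʳ-⊆ {X} {Y} X''≈Y'' g∈[X∪D]'' m upY∪Dm = g∈[X∪D]'' m λ a a∈X∪D →
      [ (λ a∈X → proj₁ (X''≈Y'' a) (∈⇒∈-closure a∈X) m (λ b b∈Y → upY∪Dm b (p⊆p∪q D b∈Y)))
      , (λ a∈D → upY∪Dm a (q⊆p∪q Y D a∈D))
      ] (x∈p∪q⁻ X D a∈X∪D)

module Construction {n : ℕ} (K : Context n) (R : Subset n) where
  open ClosureProperties K

  AgreeOutside : Subset n → Subset n → Set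
  AgreeOutside X Y = ∀ h → h ∉ R → (h ∈ X → h ∈ Y) × (h ∈ Y → h ∈ X)

  AgreeOutside-trans : ∀ {X Y Z} → AgreeOutside X Y → AgreeOutside Y Z → AgreeOutside X Z
  AgreeOutside-trans X~Y Y~Z h h∉R = (λ h∈X → proj₁ (Y~Z h h∉R) (proj₁ (X~Y h h∉R) h∈X))
                                   , (λ h∈Z → proj₂ (X~Y h h∉R) (proj₂ (Y~Z h h∉R) h∈Z))

  ClosedOutside : Subset n → Set
  ClosedOutside S = ∀ h → h ∉ R → cl S h → h ∈ S

  LexLeastGenerator : Subset n → Set
  LexLeastGenerator S = ∀ S′ → AgreeOutside S S′ → cl S′ ≈ cl S → S ≤ˡᵉˣ S′

  𝒮 : Subset n → Set
  𝒮 S = ClosedOutside S × LexLeastGenerator S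

  𝒮⇒mixed : ∀ S → 𝒮 S → IsMixedGenerator K R S
  𝒮⇒mixed S (closed , least) h = removal , addition
    where
    removal : h ∈ S → h ∈ R → ¬ (cl (S - h) ≈ cl S)
    removal h∈S h∈R [S-h]''≈S'' with x∈p⇒p-x⊂p h∈S
    ... | _ , y , y∈S , y∉S-h = y∉S-h (subst (y ∈_) S≡S-h y∈S)
      where
      agree : AgreeOutside S (S - h)
      agree h′ h′∉R = (λ h′∈S → x∈p∧x≢y⇒x∈p-y h′∈S λ { refl → h′∉R h∈R }) , p─q⊆p S ⁅ h ⁆
      S≡S-h : S ≡ S - h
      S≡S-h = ≤ˡᵉˣ-antisym S (S - h) (least (S - h) agree [S-h]''≈S'')
                                     (⊆⇒≤ˡᵉˣ (S - h) S (p─q⊆p S ⁅ h ⁆))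
    addition : h ∉ S → h ∉ R → ¬ (cl (S ∪ ⁅ h ⁆) ≈ cl S)
    addition h∉S h∉R [S∪h]''≈S'' =
      h∉S (closed h h∉R (proj₁ ([S∪h]''≈S'' h) (∈⇒∈-closure (q⊆p∪q S ⁅ h ⁆ (x∈⁅x⁆ h)))))

  𝒮-injective : ∀ S T → 𝒮 S → 𝒮 T → cl S ≈ cl T → S ≡ T
  𝒮-injective S T (S-closed , S-least) (T-closed , T-least) S''≈T'' =
    ≤ˡᵉˣ-antisym S T (S-least T agree (≈-sym S''≈T'')) (T-least S (λ h h∉R → swap (agree h h∉R)) S''≈T'')
    where
    agree : AgreeOutside S T
    agree h h∉R = (λ h∈S → T-closed h h∉R (proj₁ (S''≈T'' h) (∈⇒∈-closure h∈S)))
                , (λ h∈T → S-closed h h∉R (proj₂ (S''≈T'' h) (∈⇒∈-closure h∈T)))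

  𝒮-surjective : ExcludedMiddle 0ℓ → ∀ A → IsExtent K A → Σ[ S ∈ Subset n ] (𝒮 S × (cl S ≈ (λ g → g ∈ A)))
  𝒮-surjective em A A-extent with ≤ˡᵉˣ-least em n (λ S → AgreeOutside A S × (cl S ≈ cl A)) A
                                   ((λ _ _ → id , id) , (λ _ → id , id))
  ... | S , (A~S , S''≈A'') , least = S , (closed , least′) , ≈-trans S''≈A'' A-extent
    where
    closed : ClosedOutside S
    closed h h∉R h∈S'' = proj₁ (A~S h h∉R) (proj₁ (A-extent h) (proj₁ (S''≈A'' h) h∈S''))
    least′ : LexLeastGenerator S
    least′ S′ S~S′ S′''≈S'' = least S′ (AgreeOutside-trans A~S S~S′ , ≈-trans S′''≈S'' S''≈A'')

  𝒮-semiDownset : SemiDownset K R 𝒮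
  𝒮-semiDownset S T (closed , least) T⊆R = closed′ , least′
    where
    keep : ∀ h → h ∉ R → h ∈ S → h ∈ S ─ T
    keep h h∉R h∈S = x∈p∧x∉q⇒x∈p─q h∈S (λ h∈T → h∉R (T⊆R h∈T))
    closed′ : ClosedOutside (S ─ T)
    closed′ h h∉R h∈[S─T]'' = keep h h∉R (closed h h∉R (closure-mono (p─q⊆p S T) h h∈[S─T]''))
    least′ : LexLeastGenerator (S ─ T)
    least′ S′ S─T~S′ S′''≈[S─T]'' = p≤ˡᵉˣq∪[p∩r]⇒p─r≤ˡᵉˣq S T S′ (least (S′ ∪ (S ∩ T)) agree lifted)
      where
      agree : AgreeOutside S (S′ ∪ (S ∩ T))
      agree h h∉R =
          (λ h∈S → p⊆p∪q (S ∩ T) (proj₁ (S─T~S′ h h∉R) (keep h h∉R h∈S)))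
        , (λ h∈S′∪S∩T → [ (λ h∈S′ → p─q⊆p S T (proj₂ (S─T~S′ h h∉R) h∈S′))
                        , (λ h∈S∩T → proj₁ (x∈p∩q⁻ S T h∈S∩T))
                        ] (x∈p∪q⁻ S′ (S ∩ T) h∈S′∪S∩T))
      lifted : cl (S′ ∪ (S ∩ T)) ≈ cl S
      lifted = subst (λ X → cl (S′ ∪ (S ∩ T)) ≈ cl X) (p─q∪p∩q≡p S T)
                     (closure-cong-∪ʳ (S ∩ T) S′''≈[S─T]'')

proposition14 : ExcludedMiddle 0ℓ → (n : ℕ) (K : Context n) (R : Subset n) →
    Σ[ 𝒮 ∈ (Subset n → Set) ] (IsCompleteSystem K R 𝒮 × SemiDownset K R 𝒮)
proposition14 em n K R = 𝒮 , (𝒮⇒mixed , 𝒮-injective , 𝒮-surjective em) , 𝒮-semiDownset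
  where open Construction K R
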